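{- Every ray $R = (r_n)_{n \ge 0}$ has a unique $\mathcal{P}$-completion, i.e. there is exactly one $k \in \mathbb{N}_0$ such that $r_k$ is a $\mathcal{P}$-position. Furthermore, this $k$ satisfies $k \le |R| + 1$.
   Context: A tree nim position is a finite tree, possibly empty, each of whose vertices $v$ carries a positive integer size $|v|$. A leaf is a vertex of degree at most $1$. A move consists of choosing a leaf and decreasing its size by a positive integer; if its size becomes $0$, that vertex is deleted from the tree. The game is played under normal play (a player who cannot move, i.e. faces the empty tree, loses). A position is a $\mathcal{P}$-position if no legal move leads to a $\mathcal{P}$-position (recursively; in particular the empty position is $\mathcal{P}$); otherwise it is an $\mathcal{N}$-position. Ray: given a nonempty position $r_0$ and a vertex $v$ of $r_0$, for each $n \ge 1$ let $r_n$ be obtained from $r_0$ by adjoining a new vertex $l_0$ (the variable leaf) of size $n$ adjacent to $v$; the family $R = (r_n)_{n \ge 0}$ is the ray $r_0 \#_v l_0$. The leaf sum $|R|$ is the sum of the sizes of all leaves of $r_1$ other than $l_0$. $\mathbb{N}_0$ denotes the non-negative integers. -}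

module Defs where

open import Data.Nat using (ℕ; zero; suc; _+_; _∸_; _≤_; _<_; z≤n; s≤s)
open import Data.Nat.Properties
open import Data.Nat.Induction using (<-wellFounded)
open import Induction.WellFounded using (Acc; acc)
open import Data.List using (List; []; _∷_; _++_; [_]; length)
open import Data.Maybe using (Maybe; just; nothing)
open import Data.Bool using (Bool; true; false; if_then_else_)
open import Relation.Nullary using (¬_)
open import Relation.Binary.PropositionalEquality using (_≡_; refl; cong; sym; trans; subst)

-- A (nonempty) finite tree with a distinguished vertex is
-- represented as a rooted rose tree.  'node k ts' is a vertex of SIZE
-- suc k (sizes are positive integers) whose children are the trees ts.
-- The underlying unrooted tree is obtained by forgetting the root.

data Tree : Set where
  node : ℕ → List Tree → Tree

rootSize : Tree → ℕ
rootSize (node k _) = suc k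

Pos : Set
Pos = Maybe Tree

-- Degree of the root of a subtree, where the Bool says whether the
-- root has a parent (an extra incident edge) in the ambient tree.
degree : Bool → Tree → ℕ
degree p (node _ ts) = length ts + (if p then 1 else 0)

Leaf : Bool → Tree → Set
Leaf p t = degree p t ≤ 1

maybeToList : Maybe Tree → List Tree
maybeToList nothing  = []
maybeToList (just t) = t ∷ []

-- A move performed inside a subtree whose root has (p = true) or does
-- not have (p = false) a parent.  The result is the new subtree, or
-- nothing if the subtree vanished (a leaf with a parent deleted).
data Step : Bool → Tree → Maybe Tree → Set where
  shrink : ∀ {p k j ts} → Leaf p (node k ts) → j < k →
           Step p (node k ts) (just (node j ts))
  -- decrease size of a leaf (with a parent, hence no children) to 0:
  -- the vertex is deleted
  delete : ∀ {k} → Step true (node k []) nothing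
  inside : ∀ {p k xs t ys mt} → Step true t mt →
           Step p (node k (xs ++ t ∷ ys)) (just (node k (xs ++ maybeToList mt ++ ys)))

data Move : Pos → Pos → Set where
  step    : ∀ {t mt} → Step false t mt → Move (just t) mt
  -- the top root is a leaf of degree 0 and is decreased to 0
  delRoot0 : ∀ {k} → Move (just (node k [])) nothing
  -- the top root is a leaf of degree 1 and is decreased to 0;
  -- the remaining tree is its unique child's subtree
  delRoot1 : ∀ {k t} → Move (just (node k (t ∷ []))) (just t)

mutual
  weightT : Tree → ℕ
  weightT (node k ts) = suc k + weightL ts

  weightL : List Tree → ℕ
  weightL []       = 0
  weightL (t ∷ ts) = weightT t + weightL ts

weightM : Maybe Tree → ℕ
weightM nothing  = 0
weightM (just t) = weightT t

weightL-++ : ∀ xs ys → weightL (xs ++ ys) ≡ weightL xs + weightL ys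
weightL-++ []       ys = refl
weightL-++ (x ∷ xs) ys rewrite weightL-++ xs ys = sym (+-assoc (weightT x) (weightL xs) (weightL ys))

weightL-toList : ∀ mt → weightL (maybeToList mt) ≡ weightM mt
weightL-toList nothing  = refl
weightL-toList (just t) = +-identityʳ (weightT t)

step-dec : ∀ {p t mt} → Step p t mt → weightM mt < weightT t
step-dec (shrink {ts = ts} _ j<k) = +-monoˡ-< (weightL ts) (s≤s j<k)
step-dec delete = s≤s z≤n
step-dec (inside {k = k} {xs} {t} {ys} {mt} s) =
  subst (λ z → suc k + z < suc k + weightL (xs ++ t ∷ ys)) (sym e1)
    (subst (λ z → suc k + (weightL xs + (weightM mt + weightL ys)) < suc k + z) (sym e2)
      (+-monoʳ-< (suc k) (+-monoʳ-< (weightL xs) (+-monoˡ-< (weightL ys) (step-dec s)))))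
  where
  e1 : weightL (xs ++ maybeToList mt ++ ys) ≡ weightL xs + (weightM mt + weightL ys)
  e1 = trans (weightL-++ xs (maybeToList mt ++ ys))
         (cong (weightL xs +_) (trans (weightL-++ (maybeToList mt) ys)
           (cong (_+ weightL ys) (weightL-toList mt))))
  e2 : weightL (xs ++ t ∷ ys) ≡ weightL xs + (weightT t + weightL ys)
  e2 = weightL-++ xs (t ∷ ys)

move-dec : ∀ {p q} → Move p q → weightM q < weightM p
move-dec (step s) = step-dec s
move-dec delRoot0 = s≤s z≤n
move-dec (delRoot1 {k} {t}) =
  s≤s (subst (λ z → weightT t ≤ k + z) (sym (+-identityʳ (weightT t))) (m≤n+m (weightT t) k))

IsP-acc : (p : Pos) → Acc _<_ (weightM p) → Set
IsP-acc p (acc rs) = ∀ q → (m : Move p q) → ¬ IsP-acc q (rs (move-dec m))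

IsP : Pos → Set
IsP p = IsP-acc p (<-wellFounded (weightM p))

-- Rays.  A pair (r₀, v) is given by a tree rooted at v.  r_n (n ≥ 1)
-- adjoins a new leaf l₀ of size n as a child of v.

ray : Tree → ℕ → Pos
ray t          zero    = just t
ray (node k ts) (suc m) = just (node k (ts ++ node m [] ∷ []))

mutual
  leafSumT : Bool → Tree → ℕ
  leafSumT p (node k ts) = rootPart p k ts + leafSumL ts

  rootPart : Bool → ℕ → List Tree → ℕ
  rootPart false k []          = suc k
  rootPart false k (_ ∷ [])    = suc k
  rootPart false k (_ ∷ _ ∷ _) = 0
  rootPart true  k []          = suc k
  rootPart true  k (_ ∷ _)     = 0

  leafSumL : List Tree → ℕ
  leafSumL []       = 0
  leafSumL (t ∷ ts) = leafSumT true t + leafSumL ts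

leafSumPos : Pos → ℕ
leafSumPos nothing  = 0
leafSumPos (just t) = leafSumT false t

-- |R| : sum of the leaf sizes of r₁ other than l₀.  l₀ is a leaf of
-- r₁ of size 1, so this is the leaf sum of r₁ minus 1.
raySum : Tree → ℕ
raySum t = leafSumPos (ray t 1) ∸ 1

{-# OPTIONS --safe #-}
-- Lowering the new leaf l₀ is a move from r_b to r_a for every a < b, so at most
-- one r_k is a P-position.  Every other move of r_{i+1} is a move of r₀ in which
-- the vertex v counts as having a parent (namely l₀): lower a leaf of r₀, or delete
-- it.  There are exactly |R| such options, and each leads to r′_{i+1} on the ray of
-- the resulting r′₀ (to the single leaf l₀ if v itself is deleted).  If r₀, …, r_n
-- were all N-positions, each r_{i+1} with i < n would have a move to a P-position,
-- necessarily of the second kind; two different i using the same option would give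
-- two P-positions on one ray, so n ≤ |R|.  Hence some r_k with k ≤ |R| + 1 is P.
-- Every position has a finite list of moves, so being a P-position is decidable
-- and this search for k is constructive.
module Submission where

open import Defs
open import Data.Nat using (ℕ; _+_; _≤_)
open import Data.Product using (Σ; _×_)
open import Relation.Binary.PropositionalEquality using (_≡_)

open import Data.Bool using (Bool; true; false)
open import Data.Empty using (⊥-elim)
open import Data.Fin using (Fin; toℕ)
open import Data.Fin.Properties using (toℕ<n; toℕ-injective; injective⇒≤)
open import Data.List using (List; []; _∷_; _++_; _∷ʳ_; length; map; applyDownFrom; _∷ʳ′_; initLast)
open import Data.List.Properties using (++-assoc; ++-identityʳ; ++-conicalʳ; ∷-injectiveʳ; ∷ʳ-injective; length-++; length-map; length-applyDownFrom)
open import Data.List.Relation.Unary.Any using (Any; here; there; index; any?; fromSum; toSum)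
open import Data.List.Membership.Propositional using (_∈_; find; lose)
open import Data.List.Membership.Propositional.Properties using (∈-++⁺ˡ; ∈-++⁺ʳ; ∈-++⁻; ∈-map⁺; ∈-map⁻; ∈-applyDownFrom⁺; ∈-applyDownFrom⁻)
open import Data.List.Membership.Setoid.Properties using (index-injective)
open import Data.Maybe using (Maybe; just; nothing)
open import Data.Nat using (zero; suc; _<_; _∸_; z≤n; s≤s)
open import Data.Nat.Induction using (<-wellFounded)
open import Data.Nat.Properties using (≤-antisym; ≤-trans; <⇒≤; ≮⇒≥; suc-injective; +-assoc; m+n∸n≡m; m+1+n≰m; anyUpTo?)
open import Data.Product using (∃-syntax; _,_; proj₁; proj₂)
open import Data.Sum using (_⊎_; inj₁; inj₂)
open import Function using (_∘_)
open import Function.Bundles using (_⇔_; mk⇔; Equivalence)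
open import Function.Definitions using (Injective)
import Function.Properties.Equivalence as ⇔
open import Induction.WellFounded using (Acc; acc)
open import Relation.Binary.PropositionalEquality using (refl; sym; trans; cong; cong₂; subst; subst₂; setoid; module ≡-Reasoning)
open import Relation.Nullary using (¬_; Dec; no)
open import Relation.Nullary.Decidable using (map′; ¬?; _⊎-dec_; decidable-stable)
import Relation.Nullary.Decidable as Dec

private
  variable
    b : Bool
    k m : ℕ
    p q : Pos
    t : Tree
    mt : Maybe Tree
    ts : List Tree

any∈? : ∀ {A : Set} {P : A → Set} xs → (∀ {x} → x ∈ xs → Dec (P x)) → Dec (Any P xs)
any∈? []       P? = no λ ()
any∈? (x ∷ xs) P? = map′ fromSum toSum (P? (here refl) ⊎-dec any∈? xs (P? ∘ there))

IsP-acc-irrelevant : ∀ p (a a′ : Acc _<_ (weightM p)) → IsP-acc p a → IsP-acc p a′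
IsP-acc-irrelevant p (acc rs) (acc rs′) Pp q mv Pq =
  Pp q mv (IsP-acc-irrelevant q (rs′ (move-dec mv)) (rs (move-dec mv)) Pq)

IsP-elim : IsP p → Move p q → ¬ IsP q
IsP-elim {p} = elim (<-wellFounded (weightM p))
  where
  elim : ∀ {p q} (a : Acc _<_ (weightM p)) → IsP-acc p a → Move p q → ¬ IsP q
  elim {q = q} (acc rs) Pp mv Pq =
    Pp q mv (IsP-acc-irrelevant q (<-wellFounded (weightM q)) (rs (move-dec mv)) Pq)

IsP-intro : (∀ {q} → Move p q → ¬ IsP q) → IsP p
IsP-intro {p} noP = intro (<-wellFounded (weightM p))
  where
  intro : (a : Acc _<_ (weightM p)) → IsP-acc p a
  intro (acc rs) q mv Pq = noP mv (IsP-acc-irrelevant q (rs (move-dec mv)) (<-wellFounded (weightM q)) Pq)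

IsP-empty : IsP nothing
IsP-empty = IsP-intro λ ()

¬IsP-singleton : ∀ m → ¬ IsP (just (node m []))
¬IsP-singleton m Pm = IsP-elim Pm delRoot0 IsP-empty

shrinks : ℕ → List Tree → List (Maybe Tree)
shrinks k ts = applyDownFrom (λ j → just (node j ts)) k

rootSteps : Bool → ℕ → List Tree → List (Maybe Tree)
rootSteps true  k []          = nothing ∷ shrinks k []
rootSteps true  k (_ ∷ _)     = []
rootSteps false k []          = shrinks k []
rootSteps false k (u ∷ [])    = shrinks k (u ∷ [])
rootSteps false k (_ ∷ _ ∷ _) = []

mutual
  steps : Bool → Tree → List (Maybe Tree)
  steps b (node k ts) = rootSteps b k ts ++ map (just ∘ node k) (childSteps ts)

  childSteps : List Tree → List (List Tree)
  childSteps []       = []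
  childSteps (t ∷ ts) = map (λ mt → maybeToList mt ++ ts) (steps true t) ++ map (t ∷_) (childSteps ts)

∈-shrinks⁻ : Leaf b (node k ts) → mt ∈ shrinks k ts → Step b (node k ts) mt
∈-shrinks⁻ leaf mt∈ with j , j<k , refl ← ∈-applyDownFrom⁻ _ mt∈ = shrink leaf j<k

∈-rootSteps⁻ : ∀ b k ts → mt ∈ rootSteps b k ts → Step b (node k ts) mt
∈-rootSteps⁻ true  k []       (here refl) = delete
∈-rootSteps⁻ true  k []       (there mt∈) = ∈-shrinks⁻ (s≤s z≤n) mt∈
∈-rootSteps⁻ false k []       mt∈         = ∈-shrinks⁻ z≤n mt∈
∈-rootSteps⁻ false k (_ ∷ []) mt∈         = ∈-shrinks⁻ (s≤s z≤n) mt∈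

∈-rootSteps⁺ : ∀ b {k ts j} → Leaf b (node k ts) → j < k → just (node j ts) ∈ rootSteps b k ts
∈-rootSteps⁺ true  {ts = []}        _        j<k = there (∈-applyDownFrom⁺ _ j<k)
∈-rootSteps⁺ true  {ts = _ ∷ []}    (s≤s ()) _
∈-rootSteps⁺ true  {ts = _ ∷ _ ∷ _} (s≤s ()) _
∈-rootSteps⁺ false {ts = []}        _        j<k = ∈-applyDownFrom⁺ _ j<k
∈-rootSteps⁺ false {ts = _ ∷ []}    _        j<k = ∈-applyDownFrom⁺ _ j<k
∈-rootSteps⁺ false {ts = _ ∷ _ ∷ _} (s≤s ()) _

mutual
  ∈-steps⁻ : ∀ t → mt ∈ steps b t → Step b t mt
  ∈-steps⁻ {b = b} (node k ts) mt∈ with ∈-++⁻ (rootSteps b k ts) mt∈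
  ... | inj₁ root∈  = ∈-rootSteps⁻ b k ts root∈
  ... | inj₂ child∈ with ts′ , ts′∈ , refl ← ∈-map⁻ (just ∘ node k) child∈ =
    ∈-childSteps⁻ ts ts′∈ []

  ∈-childSteps⁻ : ∀ ts {ts′} → ts′ ∈ childSteps ts →
                  ∀ xs → Step b (node k (xs ++ ts)) (just (node k (xs ++ ts′)))
  ∈-childSteps⁻ (t ∷ ts) ts′∈ xs with ∈-++⁻ (map (λ mt → maybeToList mt ++ ts) (steps true t)) ts′∈
  ... | inj₁ head∈ with mt , mt∈ , refl ← ∈-map⁻ _ head∈ = inside {xs = xs} (∈-steps⁻ t mt∈)
  ... | inj₂ tail∈ with ts″ , ts″∈ , refl ← ∈-map⁻ (t ∷_) tail∈ =
    subst₂ (λ as bs → Step _ (node _ as) (just (node _ bs)))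
      (++-assoc xs (t ∷ []) ts) (++-assoc xs (t ∷ []) ts″) (∈-childSteps⁻ ts ts″∈ (xs ∷ʳ t))

mutual
  ∈-steps⁺ : Step b t mt → mt ∈ steps b t
  ∈-steps⁺ {b = b} (shrink leaf j<k) = ∈-++⁺ˡ (∈-rootSteps⁺ b leaf j<k)
  ∈-steps⁺ delete                    = here refl
  ∈-steps⁺ {b = b} (inside {k = k} {xs = xs} {ys = ys} s) =
    ∈-++⁺ʳ (rootSteps b k _) (∈-map⁺ (just ∘ node k) (∈-childSteps⁺ xs {ys = ys} s))

  ∈-childSteps⁺ : ∀ xs {ys} → Step true t mt → xs ++ maybeToList mt ++ ys ∈ childSteps (xs ++ t ∷ ys)
  ∈-childSteps⁺ []       {ys} s = ∈-++⁺ˡ (∈-map⁺ (λ mt → maybeToList mt ++ ys) (∈-steps⁺ s))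
  ∈-childSteps⁺ {t = t} (x ∷ xs) {ys} s =
    ∈-++⁺ʳ (map (λ mt → maybeToList mt ++ xs ++ t ∷ ys) (steps true x))
           (∈-map⁺ (x ∷_) (∈-childSteps⁺ xs s))

length-rootSteps : ∀ k ts → length (rootSteps true k ts) ≡ rootPart true k ts
length-rootSteps k []      = cong suc (length-applyDownFrom _ k)
length-rootSteps k (_ ∷ _) = refl

mutual
  length-steps : ∀ t → length (steps true t) ≡ leafSumT true t
  length-steps (node k ts) =
    trans (length-++ (rootSteps true k ts))
      (cong₂ _+_ (length-rootSteps k ts) (trans (length-map _ (childSteps ts)) (length-childSteps ts)))

  length-childSteps : ∀ ts → length (childSteps ts) ≡ leafSumL ts
  length-childSteps []       = refl
  length-childSteps (t ∷ ts) =
    trans (length-++ (map _ (steps true t)))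
      (cong₂ _+_ (trans (length-map _ (steps true t)) (length-steps t))
                 (trans (length-map _ (childSteps ts)) (length-childSteps ts)))

rootDeletions : Tree → List Pos
rootDeletions (node k [])          = nothing ∷ []
rootDeletions (node k (u ∷ []))    = just u ∷ []
rootDeletions (node k (_ ∷ _ ∷ _)) = []

moves : Pos → List Pos
moves nothing  = []
moves (just t) = rootDeletions t ++ steps false t

∈-moves⁻ : ∀ p → q ∈ moves p → Move p q
∈-moves⁻ (just t) q∈ with ∈-++⁻ (rootDeletions t) q∈
... | inj₂ step∈ = step (∈-steps⁻ t step∈)
... | inj₁ deletion∈ = deletion t deletion∈
  where
  deletion : ∀ t → q ∈ rootDeletions t → Move (just t) q
  deletion (node k [])       (here refl) = delRoot0
  deletion (node k (_ ∷ [])) (here refl) = delRoot1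

∈-moves⁺ : Move p q → q ∈ moves p
∈-moves⁺ (step {t} s) = ∈-++⁺ʳ (rootDeletions t) (∈-steps⁺ s)
∈-moves⁺ delRoot0     = here refl
∈-moves⁺ delRoot1     = here refl

IsP⇔¬AnyIsP-moves : IsP p ⇔ (¬ Any IsP (moves p))
IsP⇔¬AnyIsP-moves {p} = mk⇔
  (λ Pp anyP → let q , q∈ , Pq = find anyP in IsP-elim Pp (∈-moves⁻ p q∈) Pq)
  (λ noneP → IsP-intro λ mv Pq → noneP (lose (∈-moves⁺ mv) Pq))

isP? : ∀ p → Dec (IsP p)
isP? p = decide p (<-wellFounded (weightM p))
  where
  decide : ∀ p → Acc _<_ (weightM p) → Dec (IsP p)
  decide p (acc rs) = Dec.map (⇔.sym IsP⇔¬AnyIsP-moves)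
    (¬? (any∈? (moves p) λ q∈ → decide _ (rs (move-dec (∈-moves⁻ p q∈)))))

¬IsP⇒move-to-P : ¬ IsP p → ∃[ q ] Move p q × IsP q
¬IsP⇒move-to-P {p} ¬Pp
  with q , q∈ , Pq ← find (decidable-stable (any? isP? (moves p))
                                            (¬Pp ∘ Equivalence.from IsP⇔¬AnyIsP-moves))
  = q , ∈-moves⁻ p q∈ , Pq

ray-descend : ∀ t {a b} → a < b → Move (ray t b) (ray t a)
ray-descend (node k ts) {zero}  {suc m} _ =
  subst (λ cs → Move (ray (node k ts) (suc m)) (just (node k cs))) (++-identityʳ ts)
    (step (inside {xs = ts} {ys = []} delete))
ray-descend (node k ts) {suc j} {suc m} (s≤s j<m) =
  step (inside {xs = ts} {ys = []} (shrink (s≤s z≤n) j<m))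

ray-P-unique : ∀ t {a b} → IsP (ray t a) → IsP (ray t b) → a ≡ b
ray-P-unique t Pa Pb = ≤-antisym
  (≮⇒≥ λ b<a → IsP-elim Pa (ray-descend t b<a) Pb)
  (≮⇒≥ λ a<b → IsP-elim Pb (ray-descend t a<b) Pa)

withLeaf : Maybe Tree → ℕ → Pos
withLeaf nothing  m = just (node m [])
withLeaf (just t) m = ray t (suc m)

withLeaf-P-unique : ∀ mt {i j} → IsP (withLeaf mt i) → IsP (withLeaf mt j) → i ≡ j
withLeaf-P-unique nothing  Pi _  = ⊥-elim (¬IsP-singleton _ Pi)
withLeaf-P-unique (just t) Pi Pj = suc-injective (ray-P-unique t Pi Pj)

l₀-move : ∀ {cs} → Step true (node m cs) mt → cs ≡ [] →
          ∃[ j ] j ≤ m × just (node k (ts ++ maybeToList mt ++ [])) ≡ ray (node k ts) j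
l₀-move (shrink _ j<m) refl = suc _ , j<m , refl
l₀-move {k = k} {ts = ts} delete refl = 0 , z≤n , cong (just ∘ node k) (++-identityʳ ts)
l₀-move (inside {xs = xs} _) e with () ← ++-conicalʳ xs _ e

snoc-move-cases : ∀ {cs} → Move (just (node k cs)) q → cs ≡ ts ∷ʳ node m [] →
                  (∃[ j ] j ≤ m × q ≡ ray (node k ts) j) ⊎
                  (∃[ mt ] Step true (node k ts) mt × q ≡ withLeaf mt m)
snoc-move-cases {ts = []}        (step (shrink _ j<k)) refl = inj₂ (_ , shrink (s≤s z≤n) j<k , refl)
snoc-move-cases {ts = _ ∷ []}    (step (shrink (s≤s ()) _)) refl
snoc-move-cases {ts = _ ∷ _ ∷ _} (step (shrink (s≤s ()) _)) refl
snoc-move-cases {ts = ts} (step (inside {xs = xs} {ys = ys} s)) e with initLast ys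
... | [] with refl , refl ← ∷ʳ-injective xs ts e = inj₁ (l₀-move s refl)
... | ys′ ∷ʳ′ _ with refl , refl ← ∷ʳ-injective (xs ++ _ ∷ ys′) ts (trans (++-assoc xs (_ ∷ ys′) _) e) =
  inj₂ (_ , inside s , cong (just ∘ node _) (sym (++-assoc³ xs _ ys′ _)))
  where
  ++-assoc³ : ∀ {A : Set} (as bs cs ds : List A) → (as ++ bs ++ cs) ++ ds ≡ as ++ bs ++ cs ++ ds
  ++-assoc³ as bs cs ds = trans (++-assoc as (bs ++ cs) ds) (cong (as ++_) (++-assoc bs cs ds))
snoc-move-cases {ts = ts}     delRoot0 e    with () ← ++-conicalʳ ts _ (sym e)
snoc-move-cases {ts = []}     delRoot1 refl = inj₂ (nothing , delete , refl)
snoc-move-cases {ts = _ ∷ ts} delRoot1 e    with () ← ++-conicalʳ ts _ (sym (∷-injectiveʳ e))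

ray-move-cases : ∀ t → Move (ray t (suc m)) q →
                 (∃[ j ] j ≤ m × q ≡ ray t j) ⊎ (∃[ mt ] Step true t mt × q ≡ withLeaf mt m)
ray-move-cases (node k ts) mv = snoc-move-cases mv refl

ray-N-prefix-bound : ∀ t n → (∀ i → i ≤ n → ¬ IsP (ray t i)) → n ≤ leafSumT true t
ray-N-prefix-bound t n allN =
  subst (n ≤_) (length-steps t) (injective⇒≤ {f = replyIndex} replyIndex-injective)
  where
  reply : ∀ {i} → i < n → ∃[ mt ] mt ∈ steps true t × IsP (withLeaf mt i)
  reply {i} i<n with q , mv , Pq ← ¬IsP⇒move-to-P (allN (suc i) i<n) with ray-move-cases t mv
  ... | inj₁ (j , j≤i , refl) = ⊥-elim (allN j (≤-trans j≤i (<⇒≤ i<n)) Pq)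
  ... | inj₂ (mt , s , refl)  = mt , ∈-steps⁺ s , Pq

  replyIndex : Fin n → Fin (length (steps true t))
  replyIndex i = index (proj₁ (proj₂ (reply (toℕ<n i))))

  replyIndex-injective : Injective _≡_ _≡_ replyIndex
  replyIndex-injective {i} {j} same =
    let mt , mt∈ , Pi = reply (toℕ<n i)
        _  , mt′∈ , Pj = reply (toℕ<n j)
        mt≡mt′ = index-injective (setoid (Maybe Tree)) mt∈ mt′∈ same
        Pj′ = subst (λ x → IsP (withLeaf x (toℕ j))) (sym mt≡mt′) Pj
    in toℕ-injective (withLeaf-P-unique mt Pi Pj′)

rootPart-∷ʳ : ∀ k ts u → rootPart false k (ts ∷ʳ u) ≡ rootPart true k ts
rootPart-∷ʳ k []          u = refl
rootPart-∷ʳ k (_ ∷ [])    u = refl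
rootPart-∷ʳ k (_ ∷ _ ∷ _) u = refl

leafSumL-++ : ∀ xs ys → leafSumL (xs ++ ys) ≡ leafSumL xs + leafSumL ys
leafSumL-++ []       ys = refl
leafSumL-++ (x ∷ xs) ys =
  trans (cong (leafSumT true x +_) (leafSumL-++ xs ys))
        (sym (+-assoc (leafSumT true x) (leafSumL xs) (leafSumL ys)))

raySum≡leafSumT : ∀ t → raySum t ≡ leafSumT true t
raySum≡leafSumT (node k ts) = begin
  rootPart false k (ts ∷ʳ node 0 []) + leafSumL (ts ∷ʳ node 0 []) ∸ 1
    ≡⟨ cong₂ (λ a b → a + b ∸ 1) (rootPart-∷ʳ k ts _) (leafSumL-++ ts _) ⟩
  rootPart true k ts + (leafSumL ts + 1) ∸ 1
    ≡⟨ cong (_∸ 1) (sym (+-assoc (rootPart true k ts) (leafSumL ts) 1)) ⟩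
  rootPart true k ts + leafSumL ts + 1 ∸ 1
    ≡⟨ m+n∸n≡m _ 1 ⟩
  leafSumT true (node k ts) ∎
  where open ≡-Reasoning

ray-not-all-N : ∀ t → ¬ (∀ i → i ≤ raySum t + 1 → ¬ IsP (ray t i))
ray-not-all-N t allN = m+1+n≰m (raySum t)
  (subst (raySum t + 1 ≤_) (sym (raySum≡leafSumT t)) (ray-N-prefix-bound t (raySum t + 1) allN))

ray-P-within : ∀ t → ∃[ k ] k ≤ raySum t + 1 × IsP (ray t k)
ray-P-within t
  with k , s≤s k≤ , Pk ← decidable-stable (anyUpTo? (isP? ∘ ray t) (suc (raySum t + 1)))
                           (λ none → ray-not-all-N t λ i i≤ Pi → none (i , s≤s i≤ , Pi))
  = k , k≤ , Pk

mainTheorem4 : (t : Tree) → Σ ℕ (λ k → IsP (ray t k) × k ≤ raySum t + 1 × ((m : ℕ) → IsP (ray t m) → m ≡ k))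
mainTheorem4 t with k , k≤ , Pk ← ray-P-within t = k , Pk , k≤ , λ m Pm → ray-P-unique t Pm Pk
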